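{- Let $H$ be a multigraph and let $k \geq |E(H)|$ be an integer. Then the limit $$\pi^{\ast}_k(H)=\lim_{n \rightarrow \infty} \frac{\mathrm{ex}_k^{\ast}(n, H)}{{n \choose 2}}$$ exists.
   Context: All multigraphs have no loops (parallel edges allowed). A graph system of order $k$ on a vertex set $V$ is a tuple $\mathcal{G}=(G_1,\dots,G_k)$ of simple graphs on the common vertex set $V$. A multigraph $H$ with $V(H)\subseteq V$ is a rainbow subgraph of $\mathcal{G}$ if there is an injective map $\psi:E(H)\to[k]$ with $e\in E(G_{\psi(e)})$ for every $e\in E(H)$; $\mathcal{G}$ is rainbow $H$-free if it has no rainbow subgraph isomorphic to $H$. The rainbow extremal number $\mathrm{ex}_k^{\ast}(n,H)$ is the maximum of $\min_{1\le i\le k}|E(G_i)|$ over all rainbow $H$-free graph systems $(G_1,\dots,G_k)$ of order $k$ on $[n]$. -}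

module Defs where

open import Data.Nat using (ℕ; zero; suc; _≤_; _<ᵇ_)
open import Data.Nat.Combinatorics using (_C_)
open import Data.Bool using (Bool; true; false; _∧_; if_then_else_)
open import Data.Fin using (Fin; toℕ)
open import Data.List using (List; map; allFin)
open import Data.Nat.ListAction using (sum)
open import Data.Product using (Σ; _×_; _,_; proj₁; proj₂; ∃-syntax)
open import Data.Integer using (+_)
open import Data.Rational using (ℚ; 0ℚ; _/_)
open import Function.Definitions using (Injective)
open import Relation.Binary.PropositionalEquality using (_≡_; _≢_)
open import Relation.Nullary using (¬_)

record SimpleGraph (n : ℕ) : Set where
  field
    adj    : Fin n → Fin n → Bool
    sym    : ∀ i j → adj i j ≡ adj j i
    irrefl : ∀ i → adj i i ≡ false
open SimpleGraph public

numEdges : ∀ {n} → SimpleGraph n → ℕ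
numEdges {n} G =
  sum (map (λ i → sum (map (λ j → if (toℕ i <ᵇ toℕ j) ∧ adj G i j then 1 else 0)
                           (allFin n)))
           (allFin n))

-- A loopless multigraph with vertex set Fin nv and edge set Fin ne
-- (parallel edges allowed: distinct edges may have the same endpoints).
record Multigraph : Set where
  field
    nv     : ℕ
    ne     : ℕ
    ends   : Fin ne → Fin nv × Fin nv
    noLoop : ∀ e → proj₁ (ends e) ≢ proj₂ (ends e)
open Multigraph public

GraphSystem : ℕ → ℕ → Set
GraphSystem k n = Fin k → SimpleGraph n

HasRainbow : ∀ {k n} → GraphSystem k n → Multigraph → Set
HasRainbow {k} {n} 𝒢 H =
  Σ (Fin (nv H) → Fin n) λ φ → Σ (Fin (ne H) → Fin k) λ ψ →
    Injective _≡_ _≡_ φ × Injective _≡_ _≡_ ψ ×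
    (∀ e → adj (𝒢 (ψ e)) (φ (proj₁ (ends H e))) (φ (proj₂ (ends H e))) ≡ true)

RainbowFree : ∀ {k n} → GraphSystem k n → Multigraph → Set
RainbowFree 𝒢 H = ¬ HasRainbow 𝒢 H

MinEdgesAtLeast : ∀ {k n} → GraphSystem k n → ℕ → Set
MinEdgesAtLeast 𝒢 x = ∀ i → x ≤ numEdges (𝒢 i)

-- IsEx k n H x  :⇔  x = ex*_k(n,H), i.e. x is the maximum of min_i |E(G_i)|
-- over rainbow H-free graph systems of order k on [n].
IsEx : ℕ → ℕ → Multigraph → ℕ → Set
IsEx k n H x =
  (∃[ 𝒢 ] (RainbowFree {k} {n} 𝒢 H × MinEdgesAtLeast 𝒢 x)) ×
  (∀ (𝒢 : GraphSystem k n) y → RainbowFree 𝒢 H → MinEdgesAtLeast 𝒢 y → y ≤ x)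

-- density a n = a / (n choose 2)  (set to 0 when n choose 2 = 0, i.e. n < 2)
density : ℕ → ℕ → ℚ
density a n with n C 2
... | zero  = 0ℚ
... | suc d = (+ a) / suc d

module Submission where

-- Averaging over its n + 1 vertex-deleted subgraphs reproduces the edge density of a graph on
-- n + 1 vertices, and each deletion moves that density by at most 2/(n+1) (a mediant estimate).
-- For a graph system of order k, the variance decomposition around the mean therefore yields a
-- vertex whose deletion increases the squared distance of the k densities from any fixed vector
-- by at most k (2/(n+1))², which is summable.  So a rainbow-H-free system on n vertices contains
-- an induced, still rainbow-H-free, subsystem on m vertices whose densities are all within δ of
-- the original ones once 8k/(m+1) < δ², whence ex*(n,H)/C(n,2) - δ < ex*(m,H)/C(m,2) for all
-- large m ≤ n.  A non-negative sequence that is almost non-increasing at every scale can drop by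
-- a fixed amount only finitely often, so it is Cauchy; constructively we get the double negation.

open import Data.Fin using (Fin; zero; suc; punchIn)
open import Data.Nat using (ℕ)
open import Data.Product using (∃-syntax; _,_; proj₁; proj₂)
open import Data.Rational using (ℚ)
open import Data.Sum using (inj₁; inj₂)
open import Function using (_∘_)
open import Relation.Binary.Bundles using (TotalPreorder)

module _ {a ℓ₁ ℓ₂} (O : TotalPreorder a ℓ₁ ℓ₂) where
  open TotalPreorder O
  import Data.Nat as ℕ

  ∃-argmin : ∀ {n} (f : Fin (ℕ.suc n) → Carrier) → ∃[ i ] ∀ j → f i ≲ f j
  ∃-argmin {ℕ.zero} f = zero , λ where zero → refl
  ∃-argmin {ℕ.suc n} f with ∃-argmin (f ∘ suc)
  ... | i , fi≲ with total (f zero) (f (suc i))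
  ...   | inj₁ f0≲fi = zero , λ where
                         zero    → refl
                         (suc j) → trans f0≲fi (fi≲ j)
  ...   | inj₂ fi≲f0 = suc i , λ where
                         zero    → fi≲f0
                         (suc j) → fi≲ j

module Rational where
  open import Algebra.Bundles using (Ring)
  import Algebra.Properties.Semiring.Sum as Sum
  open import Data.Integer as ℤ using (+_; -[1+_])
  import Data.Integer.Properties as ℤP
  open import Data.Nat as ℕ using (zero; suc; z≤n; s≤s)
  import Data.Nat.Properties as ℕP
  open import Data.Rational public
    using (ℚ; mkℚ; 0ℚ; 1ℚ; _+_; _*_; -_; _-_; _/_; _≤_; _<_; 1/_; ∣_∣)
  import Data.Rational as ℚ
  open import Data.Rational.Literals using (fromℤ)
  open import Data.Rational.Properties
  import Data.Rational.Unnormalised as ℚᵘ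
  import Data.Rational.Unnormalised.Properties as ℚᵘP
  open import Data.Vec.Functional using (Vector; replicate)
  open import Level using (0ℓ)
  open import Relation.Binary.PropositionalEquality
  open import Relation.Nullary using (yes; no; contradiction)
  open import Relation.Nullary.Decidable using (dec⇒maybe)
  open import Tactic.RingSolver using (solve-∀)
  open import Tactic.RingSolver.Core.AlmostCommutativeRing
    using (AlmostCommutativeRing; fromCommutativeRing)

  open Sum (Ring.semiring +-*-ring) public
    using (sum; sum-cong-≗; sum-remove; sum-replicate-zero; ∑-distrib-+; ∑-comm; *-distribˡ-sum; *-distribʳ-sum)
  module ℕΣ = Sum ℕP.+-*-semiring

  ℚ-ring : AlmostCommutativeRing 0ℓ 0ℓ
  ℚ-ring = fromCommutativeRing +-*-commutativeRing (λ p → dec⇒maybe (0ℚ ≟ p))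

  fromℕ : ℕ → ℚ
  fromℕ n = fromℤ (+ n)

  fromℕ-homo-+ : ∀ m n → fromℕ (m ℕ.+ n) ≡ fromℕ m + fromℕ n
  fromℕ-homo-+ m n =
    toℚᵘ-injective (ℚᵘP.≃-trans (ℚᵘ.*≡* eq) (ℚᵘP.≃-sym (toℚᵘ-homo-+ (fromℕ m) (fromℕ n))))
    where
    eq : + (m ℕ.+ n) ℤ.* + 1 ≡ (+ m ℤ.* + 1 ℤ.+ + n ℤ.* + 1) ℤ.* + 1
    eq = cong (ℤ._* + 1)
      (trans (ℤP.pos-+ m n) (sym (cong₂ ℤ._+_ (ℤP.*-identityʳ (+ m)) (ℤP.*-identityʳ (+ n)))))

  fromℕ-homo-* : ∀ m n → fromℕ (m ℕ.* n) ≡ fromℕ m * fromℕ n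
  fromℕ-homo-* m n =
    toℚᵘ-injective (ℚᵘP.≃-trans (ℚᵘ.*≡* eq) (ℚᵘP.≃-sym (toℚᵘ-homo-* (fromℕ m) (fromℕ n))))
    where
    eq : + (m ℕ.* n) ℤ.* + 1 ≡ (+ m ℤ.* + n) ℤ.* + 1
    eq = cong (ℤ._* + 1) (ℤP.pos-* m n)

  fromℕ-mono-≤ : ∀ {m n} → m ℕ.≤ n → fromℕ m ≤ fromℕ n
  fromℕ-mono-≤ m≤n = ℚ.*≤* (ℤP.*-monoʳ-≤-nonNeg (+ 1) (ℤ.+≤+ m≤n))

  fromℕ-mono-< : ∀ {m n} → m ℕ.< n → fromℕ m < fromℕ n
  fromℕ-mono-< m<n = ℚ.*<* (ℤP.*-monoʳ-<-pos (+ 1) (ℤ.+<+ m<n))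

  fromℕ-nonNeg : ∀ n → 0ℚ ≤ fromℕ n
  fromℕ-nonNeg n = fromℕ-mono-≤ z≤n

  /-*-fromℕ : ∀ a d → (+ a / suc d) * fromℕ (suc d) ≡ fromℕ a
  /-*-fromℕ a d = toℚᵘ-injective (ℚᵘP.≃-trans (toℚᵘ-homo-* (+ a / suc d) (fromℕ (suc d)))
    (ℚᵘP.≃-trans (ℚᵘP.*-congʳ (toℚᵘ-fromℚᵘ (ℚᵘ.mkℚᵘ (+ a) d))) (ℚᵘ.*≡* eq)))
    where
    eq : (+ a ℤ.* + suc d) ℤ.* + 1 ≡ + a ℤ.* + (suc d ℕ.* 1)
    eq = trans (ℤP.*-identityʳ _) (cong (λ n → + a ℤ.* + n) (sym (ℕP.*-identityʳ (suc d))))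

  archimedean : ∀ p q → 0ℚ < q → ∃[ n ] p < fromℕ n * q
  archimedean p q 0<q = n , subst (_< fromℕ n * q) p/q*q≡p (*-monoˡ-<-pos q p/q<n)
    where
    instance
      q-pos : ℚ.Positive q
      q-pos = ℚ.positive 0<q
      q≢0 : ℚ.NonZero q
      q≢0 = pos⇒nonZero q
    <fromℕ : ∀ r → ∃[ n ] r < fromℕ n
    <fromℕ (mkℚ (+ n) d _) = suc n , ≤-<-trans
      (ℚ.*≤* (ℤP.*-monoˡ-≤-nonNeg (+ n) (ℤ.+≤+ (s≤s z≤n)))) (fromℕ-mono-< (ℕP.n<1+n n))
    <fromℕ (mkℚ -[1+ n ] d _) = 0 , ℚ.*<* ℤ.-<+
    n = proj₁ (<fromℕ (p * 1/ q))
    p/q<n = proj₂ (<fromℕ (p * 1/ q))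
    p/q*q≡p : p * 1/ q * q ≡ p
    p/q*q≡p = trans (*-assoc p (1/ q) q) (trans (cong (p *_) (*-inverseˡ q)) (*-identityʳ p))

  *-cancelʳ-≡-pos : ∀ {p q} r → 0ℚ < r → p * r ≡ q * r → p ≡ q
  *-cancelʳ-≡-pos r 0<r pr≡qr =
    ≤-antisym (*-cancelʳ-≤-pos r (≤-reflexive pr≡qr)) (*-cancelʳ-≤-pos r (≤-reflexive (sym pr≡qr)))
    where
    instance
      r-pos : ℚ.Positive r
      r-pos = ℚ.positive 0<r

  p≤q⇒0≤q-p : ∀ {p q} → p ≤ q → 0ℚ ≤ q - p
  p≤q⇒0≤q-p {p} {q} p≤q = subst (_≤ q - p) (+-inverseʳ p) (+-monoˡ-≤ (- p) p≤q)

  0≤q-p⇒p≤q : ∀ {p q} → 0ℚ ≤ q - p → p ≤ q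
  0≤q-p⇒p≤q {p} {q} 0≤q-p = subst₂ _≤_ (+-identityˡ p) (q-p+p≡q p q) (+-monoˡ-≤ p 0≤q-p)
    where
    q-p+p≡q : ∀ p q → q - p + p ≡ q
    q-p+p≡q = solve-∀ ℚ-ring

  *-nonNeg : ∀ {p q} → 0ℚ ≤ p → 0ℚ ≤ q → 0ℚ ≤ p * q
  *-nonNeg {p} {q} 0≤p 0≤q =
    nonNegative⁻¹ _ {{nonNeg*nonNeg⇒nonNeg p {{ℚ.nonNegative 0≤p}} q {{ℚ.nonNegative 0≤q}}}}

  *-pos : ∀ {p q} → 0ℚ < p → 0ℚ < q → 0ℚ < p * q
  *-pos {p} {q} 0<p 0<q = positive⁻¹ _ {{pos*pos⇒pos p {{ℚ.positive 0<p}} q {{ℚ.positive 0<q}}}}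

  p-r<q⇒p-q<r : ∀ {p q r} → p - r < q → p - q < r
  p-r<q⇒p-q<r {p} {q} {r} p-r<q = subst₂ _<_ (shiftˡ p q r) (shiftʳ q r) (+-monoˡ-< (r - q) p-r<q)
    where
    shiftˡ : ∀ p q r → p - r + (r - q) ≡ p - q
    shiftˡ = solve-∀ ℚ-ring
    shiftʳ : ∀ q r → q + (r - q) ≡ r
    shiftʳ = solve-∀ ℚ-ring

  p-r<q∧q-r<p⇒∣p-q∣<r : ∀ {p q r} → p - r < q → q - r < p → ∣ p - q ∣ < r
  p-r<q∧q-r<p⇒∣p-q∣<r {p} {q} {r} p-r<q q-r<p with ∣p∣≡p∨∣p∣≡-p (p - q)
  ... | inj₁ ∣p-q∣≡p-q = subst (_< r) (sym ∣p-q∣≡p-q) (p-r<q⇒p-q<r {p} p-r<q)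
  ... | inj₂ ∣p-q∣≡q-p = subst (_< r) (sym (trans ∣p-q∣≡q-p (negate p q))) (p-r<q⇒p-q<r {q} q-r<p)
    where
    negate : ∀ p q → - (p - q) ≡ q - p
    negate = solve-∀ ℚ-ring

  infix 8 _²
  _² : ℚ → ℚ
  p ² = p * p

  ²-nonNeg : ∀ p → 0ℚ ≤ p ²
  ²-nonNeg p with ≤-total 0ℚ p
  ... | inj₁ 0≤p = *-nonNeg 0≤p 0≤p
  ... | inj₂ p≤0 = subst (0ℚ ≤_) (neg-square p) (*-nonNeg (neg-antimono-≤ p≤0) (neg-antimono-≤ p≤0))
    where
    neg-square : ∀ p → (- p) * (- p) ≡ p * p
    neg-square = solve-∀ ℚ-ring

  ²-mono-≤ : ∀ {p q} → 0ℚ ≤ p → p ≤ q → p ² ≤ q ²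
  ²-mono-≤ {p} {q} 0≤p p≤q = ≤-trans (*-monoˡ-≤-nonNeg p p≤q) (*-monoʳ-≤-nonNeg q p≤q)
    where
    instance
      p-nonNeg : ℚ.NonNegative p
      p-nonNeg = ℚ.nonNegative 0≤p
      q-nonNeg : ℚ.NonNegative q
      q-nonNeg = ℚ.nonNegative (≤-trans 0≤p p≤q)

  -r≤p≤r⇒p²≤r² : ∀ {p r} → - r ≤ p → p ≤ r → p ² ≤ r ²
  -r≤p≤r⇒p²≤r² {p} {r} -r≤p p≤r =
    0≤q-p⇒p≤q (subst (0ℚ ≤_) (factor p r) (*-nonNeg (p≤q⇒0≤q-p p≤r) (p≤q⇒0≤q-p -r≤p)))
    where
    factor : ∀ p r → (r - p) * (p - - r) ≡ r * r - p * p
    factor = solve-∀ ℚ-ring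

  [x-y]²<γ²⇒y-γ<x : ∀ {x y γ} → 0ℚ ≤ γ → (x - y) ² < γ ² → y - γ < x
  [x-y]²<γ²⇒y-γ<x {x} {y} {γ} 0≤γ [x-y]²<γ² with y - γ <? x
  ... | yes y-γ<x = y-γ<x
  ... | no y-γ≮x = contradiction
    (<-≤-trans [x-y]²<γ² (subst (γ ² ≤_) (flip x y) (²-mono-≤ 0≤γ γ≤y-x))) (<-irrefl refl)
    where
    flip : ∀ x y → (y - x) * (y - x) ≡ (x - y) * (x - y)
    flip = solve-∀ ℚ-ring
    regroup : ∀ x y γ → y - γ - x ≡ y - x - γ
    regroup = solve-∀ ℚ-ring
    γ≤y-x : γ ≤ y - x
    γ≤y-x = 0≤q-p⇒p≤q (subst (0ℚ ≤_) (regroup x y γ) (p≤q⇒0≤q-p (≮⇒≥ y-γ≮x)))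

  -- (a + b)/(c + d) - a/c = (bc - ad)/(c(c + d)), and |bc - ad| ≤ cd.
  mediant-dist² : ∀ {a b c d x y r} → 0ℚ ≤ a → a ≤ c → 0ℚ ≤ b → b ≤ d → 0ℚ < c →
                  x * c ≡ a → y * (c + d) ≡ a + b → r * (c + d) ≡ d → (x - y) ² ≤ r ²
  mediant-dist² {a} {b} {c} {d} {x} {y} {r} 0≤a a≤c 0≤b b≤d 0<c xc≡a y[c+d]≡a+b r[c+d]≡d =
    *-cancelʳ-≤-pos (D ²) {{ℚ.positive (*-pos 0<D 0<D)}} (begin
      (x - y) ² * D ²    ≡⟨ square-* (x - y) D ⟩
      ((x - y) * D) ²    ≡⟨ cong _² [x-y]D≡ad-bc ⟩
      (a * d - b * c) ²  ≤⟨ -r≤p≤r⇒p²≤r² lower upper ⟩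
      (d * c) ²          ≡⟨ cong _² rD≡dc ⟨
      (r * D) ²          ≡⟨ square-* r D ⟨
      r ² * D ²          ∎)
    where
    open ≤-Reasoning
    D = c * (c + d)
    0≤c = <⇒≤ 0<c
    0≤d = ≤-trans 0≤b b≤d
    0<D : 0ℚ < D
    0<D = *-pos 0<c (≤-<-trans 0≤d (subst (_< c + d) (+-identityˡ d) (+-monoˡ-< d 0<c)))
    square-* : ∀ p q → p * p * (q * q) ≡ (p * q) * (p * q)
    square-* = solve-∀ ℚ-ring
    regroup : ∀ x y c d → (x - y) * (c * (c + d)) ≡ x * c * (c + d) - y * (c + d) * c
    regroup = solve-∀ ℚ-ring
    simplify : ∀ a b c d → a * (c + d) - (a + b) * c ≡ a * d - b * c
    simplify = solve-∀ ℚ-ring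
    [x-y]D≡ad-bc : (x - y) * D ≡ a * d - b * c
    [x-y]D≡ad-bc = begin-equality
      (x - y) * D                        ≡⟨ regroup x y c d ⟩
      x * c * (c + d) - y * (c + d) * c  ≡⟨ cong₂ (λ p q → p * (c + d) - q * c) xc≡a y[c+d]≡a+b ⟩
      a * (c + d) - (a + b) * c          ≡⟨ simplify a b c d ⟩
      a * d - b * c                      ∎
    rD≡dc : r * D ≡ d * c
    rD≡dc = trans (rearrange r c d) (cong (_* c) r[c+d]≡d)
      where
      rearrange : ∀ r c d → r * (c * (c + d)) ≡ r * (c + d) * c
      rearrange = solve-∀ ℚ-ring
    upper : a * d - b * c ≤ d * c
    upper = 0≤q-p⇒p≤q (subst (0ℚ ≤_) (gap a b c d)
      (+-mono-≤ (*-nonNeg (p≤q⇒0≤q-p a≤c) 0≤d) (*-nonNeg 0≤b 0≤c)))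
      where
      gap : ∀ a b c d → (c - a) * d + b * c ≡ d * c - (a * d - b * c)
      gap = solve-∀ ℚ-ring
    lower : - (d * c) ≤ a * d - b * c
    lower = 0≤q-p⇒p≤q (subst (0ℚ ≤_) (gap a b c d)
      (+-mono-≤ (*-nonNeg 0≤a 0≤d) (*-nonNeg 0≤c (p≤q⇒0≤q-p b≤d))))
      where
      gap : ∀ a b c d → a * d + c * (d - b) ≡ (a * d - b * c) - - (d * c)
      gap = solve-∀ ℚ-ring

  fromℕ-homo-sum : ∀ {n} (f : Vector ℕ n) → fromℕ (ℕΣ.sum f) ≡ sum (fromℕ ∘ f)
  fromℕ-homo-sum {zero} f = refl
  fromℕ-homo-sum {suc n} f =
    trans (fromℕ-homo-+ (f zero) _) (cong (_+_ (fromℕ (f zero))) (fromℕ-homo-sum (f ∘ suc)))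

  sum-mono-≤ : ∀ {n} {f g : Vector ℚ n} → (∀ i → f i ≤ g i) → sum f ≤ sum g
  sum-mono-≤ {zero} f≤g = ≤-refl
  sum-mono-≤ {suc n} f≤g = +-mono-≤ (f≤g zero) (sum-mono-≤ (f≤g ∘ suc))

  sum-replicate-* : ∀ n p → sum (replicate n p) ≡ fromℕ n * p
  sum-replicate-* zero p = sym (*-zeroˡ p)
  sum-replicate-* (suc n) p = begin
    p + sum (replicate n p)  ≡⟨ cong (_+_ p) (sum-replicate-* n p) ⟩
    p + fromℕ n * p          ≡⟨ distrib p (fromℕ n) ⟩
    (1ℚ + fromℕ n) * p       ≡⟨ cong (_* p) (fromℕ-homo-+ 1 n) ⟨
    fromℕ (suc n) * p        ∎
    where
    open ≡-Reasoning
    distrib : ∀ p m → p + m * p ≡ (1ℚ + m) * p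
    distrib = solve-∀ ℚ-ring

  term≤sum : ∀ {n} (f : Vector ℚ n) → (∀ i → 0ℚ ≤ f i) → ∀ i → f i ≤ sum f
  term≤sum {suc n} f 0≤f i = begin
    f i                         ≡⟨ +-identityʳ (f i) ⟨
    f i + 0ℚ                    ≡⟨ cong (_+_ (f i)) (sum-replicate-zero n) ⟨
    f i + sum (replicate n 0ℚ)  ≤⟨ +-monoʳ-≤ (f i) (sum-mono-≤ (0≤f ∘ punchIn i)) ⟩
    f i + sum (f ∘ punchIn i)   ≡⟨ sum-remove f ⟨
    sum f                       ∎
    where open ≤-Reasoning

  sum-sq-shift : ∀ {n} (x : Vector ℚ n) c d → sum x ≡ fromℕ n * d →
                 sum (λ v → (x v - c) ²) ≡ sum (λ v → (x v - d) ²) + fromℕ n * (d - c) ²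
  sum-sq-shift {n} x c d Σx≡nd = begin
    sum (λ v → (x v - c) ²)                            ≡⟨ sum-cong-≗ (λ v → expand (x v) c d) ⟩
    sum (λ v → (x v - d) ² + (t * x v + u))            ≡⟨ ∑-distrib-+ (λ v → (x v - d) ²) _ ⟩
    sum (λ v → (x v - d) ²) + sum (λ v → t * x v + u)  ≡⟨ cong (_+_ (sum (λ v → (x v - d) ²))) linear ⟩
    sum (λ v → (x v - d) ²) + fromℕ n * (d - c) ²      ∎
    where
    open ≡-Reasoning
    t = (d - c) + (d - c)
    u = (d - c) ² - t * d
    expand : ∀ x c d → (x - c) * (x - c) ≡
             (x - d) * (x - d) + (((d - c) + (d - c)) * x + ((d - c) * (d - c) - ((d - c) + (d - c)) * d))
    expand = solve-∀ ℚ-ring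
    collect : ∀ t m d u → t * (m * d) + m * u ≡ m * (t * d + u)
    collect = solve-∀ ℚ-ring
    cancel : ∀ t d w → t * d + (w - t * d) ≡ w
    cancel = solve-∀ ℚ-ring
    linear : sum (λ v → t * x v + u) ≡ fromℕ n * (d - c) ²
    linear = begin
      sum (λ v → t * x v + u)                    ≡⟨ ∑-distrib-+ (λ v → t * x v) (replicate n u) ⟩
      sum (λ v → t * x v) + sum (replicate n u)  ≡⟨ cong₂ _+_ (sym (*-distribˡ-sum t x)) (sum-replicate-* n u) ⟩
      t * sum x + fromℕ n * u                    ≡⟨ cong (λ s → t * s + fromℕ n * u) Σx≡nd ⟩
      t * (fromℕ n * d) + fromℕ n * u            ≡⟨ collect t (fromℕ n) d u ⟩
      fromℕ n * (t * d + u)                      ≡⟨ cong (fromℕ n *_) (cancel t d ((d - c) ²)) ⟩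
      fromℕ n * (d - c) ²                        ∎

  ∃-≤-mean : ∀ {n} (f : Vector ℚ (suc n)) t → sum f ≤ fromℕ (suc n) * t → ∃[ v ] f v ≤ t
  ∃-≤-mean {n} f t Σf≤[1+n]t =
    let v , v-min = ∃-argmin ≤-totalPreorder f
    in v , *-cancelˡ-≤-pos (fromℕ (suc n)) (begin
      fromℕ (suc n) * f v            ≡⟨ sum-replicate-* (suc n) (f v) ⟨
      sum (replicate (suc n) (f v))  ≤⟨ sum-mono-≤ v-min ⟩
      sum f                          ≤⟨ Σf≤[1+n]t ⟩
      fromℕ (suc n) * t              ∎)
    where open ≤-Reasoning

module Cauchy {A : Set} (P : ℕ → A → Set) (val : ℕ → A → ℚ) where
  open import Data.Empty using (⊥-elim)
  open import Data.Nat as ℕ using (zero; suc; _≤_)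
  import Data.Nat.Properties as ℕP
  open import Data.Product using (_×_)
  import Data.Rational as ℚ
  open import Data.Rational using (½)
  import Data.Rational.Properties as ℚP
  open import Data.Rational.Properties using (+-monoˡ-<; +-monoʳ-≤; neg-antimono-≤; module ≤-Reasoning)
  open import Relation.Binary.PropositionalEquality
  open import Relation.Nullary using (¬_; yes; no)
  open import Tactic.RingSolver using (solve-∀)
  open Rational hiding (_≤_)

  AlmostNonIncreasingFrom : ℚ → ℕ → Set
  AlmostNonIncreasingFrom γ M = ∀ {m n a b} → M ≤ m → m ≤ n → P m a → P n b → val n b - γ < val m a

  StableFrom : ℚ → ℕ → Set
  StableFrom ε N = ∀ {m n a b} → N ≤ m → m ≤ n → P m a → P n b → val m a - ε < val n b

  CauchyFrom : ℚ → ℕ → Set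
  CauchyFrom ε N = ∀ m n a b → N ≤ m → N ≤ n → P m a → P n b → ∣ val m a - val n b ∣ < ε

  -- Each failure of stability beyond N exhibits a later value at least γ below val N x;
  -- as values are non-negative, this can only happen finitely often.
  descent : (∀ n a → 0ℚ ℚ.≤ val n a) → ∀ {γ M} → AlmostNonIncreasingFrom γ M →
            ∀ j {N x} → M ≤ N → P N x → val N x < fromℕ j * γ →
            ¬ ¬ (∃[ N′ ] M ≤ N′ × StableFrom (γ + γ) N′)
  descent nonNeg {γ} mono zero {N} {x} _ _ x<0γ _ =
    ℚP.<-irrefl refl (ℚP.≤-<-trans (nonNeg N x) (subst (val N x <_) (ℚP.*-zeroˡ γ) x<0γ))
  descent nonNeg {γ} {M} mono (suc j) {N} {x} M≤N Px x<[1+j]γ ¬stable = ¬stable (N , M≤N , stable)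
    where
    stable : StableFrom (γ + γ) N
    stable {m} {n} {a} {b} N≤m m≤n Pa Pb with val m a - (γ + γ) ℚ.<? val n b
    ... | yes a-2γ<b = a-2γ<b
    ... | no a-2γ≮b =
      ⊥-elim (descent nonNeg mono j (ℕP.≤-trans M≤N (ℕP.≤-trans N≤m m≤n)) Pb b<jγ ¬stable)
      where
      open ≤-Reasoning
      regroup : ∀ a γ → a - (γ + γ) ≡ a - γ - γ
      regroup = solve-∀ ℚ-ring
      cancel : ∀ j γ → (1ℚ + j) * γ - γ ≡ j * γ
      cancel = solve-∀ ℚ-ring
      b<jγ : val n b < fromℕ j * γ
      b<jγ = begin-strict
        val n b                 ≤⟨ ℚP.≮⇒≥ a-2γ≮b ⟩
        val m a - (γ + γ)       ≡⟨ regroup (val m a) γ ⟩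
        val m a - γ - γ         <⟨ +-monoˡ-< (- γ) (mono M≤N N≤m Px Pa) ⟩
        val N x - γ             <⟨ +-monoˡ-< (- γ) x<[1+j]γ ⟩
        fromℕ (suc j) * γ - γ   ≡⟨ cong (λ s → s * γ - γ) (fromℕ-homo-+ 1 j) ⟩
        (1ℚ + fromℕ j) * γ - γ  ≡⟨ cancel (fromℕ j) γ ⟩
        fromℕ j * γ             ∎

  ¬¬-cauchy : (∀ n a → 0ℚ ℚ.≤ val n a) → (∀ γ → 0ℚ < γ → ∃[ M ] AlmostNonIncreasingFrom γ M) →
              ∀ ε → 0ℚ < ε → ¬ ¬ (∃[ N ] CauchyFrom ε N)
  ¬¬-cauchy nonNeg almost ε 0<ε ¬cauchy =
    let M , mono = almost γ 0<γ
    in ¬cauchy (M , λ m n a b M≤m _ Pa _ → ⊥-elim (no-value-beyond mono M≤m Pa))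
    where
    γ = ε * ½
    0<γ : 0ℚ < γ
    0<γ = *-pos 0<ε (ℚP.positive⁻¹ ½)
    halves : ∀ ε → ε * ½ + ε * ½ ≡ ε
    halves = solve-∀ ℚ-ring
    γ≤ε : γ ℚ.≤ ε
    γ≤ε = 0≤q-p⇒p≤q (subst (0ℚ ℚ.≤_) (other-half ε) (ℚP.<⇒≤ 0<γ))
      where
      other-half : ∀ ε → ε * ½ ≡ ε - ε * ½
      other-half = solve-∀ ℚ-ring
    weaken : ∀ {p q} → p - γ < q → p - ε < q
    weaken {p} p-γ<q = ℚP.≤-<-trans (+-monoʳ-≤ p (neg-antimono-≤ γ≤ε)) p-γ<q
    cauchy : ∀ {M N} → AlmostNonIncreasingFrom γ M → M ≤ N → StableFrom (γ + γ) N → CauchyFrom ε N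
    cauchy mono M≤N stable m n a b N≤m N≤n Pa Pb with ℕP.≤-total m n
    ... | inj₁ m≤n = p-r<q∧q-r<p⇒∣p-q∣<r
      (subst (λ e → val m a - e < val n b) (halves ε) (stable N≤m m≤n Pa Pb))
      (weaken {val n b} (mono (ℕP.≤-trans M≤N N≤m) m≤n Pa Pb))
    ... | inj₂ n≤m = p-r<q∧q-r<p⇒∣p-q∣<r
      (weaken {val m a} (mono (ℕP.≤-trans M≤N N≤n) n≤m Pb Pa))
      (subst (λ e → val n b - e < val m a) (halves ε) (stable N≤n n≤m Pb Pa))
    -- Values beyond M need not exist; refuting each of them makes CauchyFrom ε M vacuous.
    no-value-beyond : ∀ {M N x} → AlmostNonIncreasingFrom γ M → M ≤ N → ¬ P N x
    no-value-beyond {N = N} {x} mono M≤N Px =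
      let j , x<jγ = archimedean (val N x) γ 0<γ
      in descent nonNeg mono j M≤N Px x<jγ λ (N′ , M≤N′ , stable) → ¬cauchy (N′ , cauchy mono M≤N′ stable)

module Graph where
  open import Defs hiding (sym)
  import Algebra.Properties.Semiring.Sum as Sum
  open import Data.Bool using (true; false; _∧_; if_then_else_)
  open import Data.Fin using (toℕ)
  open import Data.Fin.Properties using (toℕ-injective; punchIn-injective)
  import Data.List as List
  open import Data.List.Properties using (map-tabulate; map-cong)
  open import Data.Nat
  open import Data.Nat.Combinatorics using (_C_; nC1≡n; nCk+nC[k+1]≡[n+1]C[k+1])
  import Data.Nat.ListAction as ListAction
  open import Data.Nat.Properties
  open import Data.Nat.Tactic.RingSolver using (solve-∀)
  open import Data.Vec.Functional using (Vector; replicate)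
  open import Function.Definitions using (Injective)
  open import Relation.Binary.PropositionalEquality
    using (_≡_; refl; sym; trans; cong; cong₂; module ≡-Reasoning)
  open import Relation.Nullary using (contradiction)
  open import Relation.Nullary.Reflects using (ofʸ; ofⁿ)
  open Sum +-*-semiring using (sum; sum-cong-≗; sum-remove; ∑-distrib-+; ∑-comm)

  sum-replicate-* : ∀ n c → sum (replicate n c) ≡ n * c
  sum-replicate-* zero c = refl
  sum-replicate-* (suc n) c = cong (c +_) (sum-replicate-* n c)

  sum-mono-≤ : ∀ {n} {f g : Vector ℕ n} → (∀ i → f i ≤ g i) → sum f ≤ sum g
  sum-mono-≤ {zero} f≤g = z≤n
  sum-mono-≤ {suc n} f≤g = +-mono-≤ (f≤g zero) (sum-mono-≤ (f≤g ∘ suc))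

  sum-tabulate : ∀ {n} (f : Vector ℕ n) → ListAction.sum (List.tabulate f) ≡ sum f
  sum-tabulate {zero} f = refl
  sum-tabulate {suc n} f = cong (f zero +_) (sum-tabulate (f ∘ suc))

  sum-allFin : ∀ {n} (f : Vector ℕ n) → ListAction.sum (List.map f (List.allFin n)) ≡ sum f
  sum-allFin f = trans (cong ListAction.sum (map-tabulate (λ i → i) f)) (sum-tabulate f)

  C2-suc : ∀ n → suc n C 2 ≡ n + n C 2
  C2-suc n = trans (sym (nCk+nC[k+1]≡[n+1]C[k+1] n 1)) (cong (_+ n C 2) (nC1≡n n))

  2*C2-suc : ∀ n → 2 * (suc n C 2) ≡ suc n * n
  2*C2-suc zero = refl
  2*C2-suc (suc n) = begin
    2 * (suc (suc n) C 2)        ≡⟨ cong (2 *_) (C2-suc (suc n)) ⟩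
    2 * (suc n + suc n C 2)      ≡⟨ *-distribˡ-+ 2 (suc n) (suc n C 2) ⟩
    2 * suc n + 2 * (suc n C 2)  ≡⟨ cong (2 * suc n +_) (2*C2-suc n) ⟩
    2 * suc n + suc n * n        ≡⟨ expand n ⟩
    suc (suc n) * suc n          ∎
    where
    open ≡-Reasoning
    expand : ∀ n → 2 * suc n + suc n * n ≡ suc (suc n) * suc n
    expand = solve-∀

  [1+n]nC2+2[1+n]C2≡[1+n][1+n]C2 : ∀ n → suc n * (n C 2) + 2 * (suc n C 2) ≡ suc n * (suc n C 2)
  [1+n]nC2+2[1+n]C2≡[1+n][1+n]C2 n = begin
    suc n * (n C 2) + 2 * (suc n C 2)  ≡⟨ cong (suc n * (n C 2) +_) (2*C2-suc n) ⟩
    suc n * (n C 2) + suc n * n        ≡⟨ *-distribˡ-+ (suc n) (n C 2) n ⟨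
    suc n * (n C 2 + n)                ≡⟨ cong (suc n *_) (trans (+-comm (n C 2) n) (sym (C2-suc n))) ⟩
    suc n * (suc n C 2)                ∎
    where open ≡-Reasoning

  induce : ∀ {m n} → (Fin m → Fin n) → SimpleGraph n → SimpleGraph m
  induce f G = record
    { adj    = λ i j → adj G (f i) (f j)
    ; sym    = λ i j → SimpleGraph.sym G (f i) (f j)
    ; irrefl = λ i → irrefl G (f i)
    }

  induce-rainbowFree : ∀ {k m n H} {f : Fin m → Fin n} {𝒢 : GraphSystem k n} →
                       Injective _≡_ _≡_ f → RainbowFree 𝒢 H → RainbowFree (λ i → induce f (𝒢 i)) H
  induce-rainbowFree {f = f} f-inj 𝒢-free (φ , ψ , φ-inj , ψ-inj , edges) =
    𝒢-free (f ∘ φ , ψ , φ-inj ∘ f-inj , ψ-inj , edges)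

  deleteVertex : ∀ {n} → SimpleGraph (suc n) → Fin (suc n) → SimpleGraph n
  deleteVertex G v = induce (punchIn v) G

  deleteVertexˢ : ∀ {k n} → GraphSystem k (suc n) → Fin (suc n) → GraphSystem k n
  deleteVertexˢ 𝒢 v i = deleteVertex (𝒢 i) v

  deleteVertexˢ-rainbowFree : ∀ {k n H} {𝒢 : GraphSystem k (suc n)} v →
                              RainbowFree 𝒢 H → RainbowFree (deleteVertexˢ 𝒢 v) H
  deleteVertexˢ-rainbowFree {H = H} {𝒢} v =
    induce-rainbowFree {H = H} {f = punchIn v} {𝒢} (punchIn-injective v _ _)

  adjacency : ∀ {n} → SimpleGraph n → Fin n → Fin n → ℕ
  adjacency G i j = if adj G i j then 1 else 0

  upperAdjacency : ∀ {n} → SimpleGraph n → Fin n → Fin n → ℕ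
  upperAdjacency G i j = if (toℕ i <ᵇ toℕ j) ∧ adj G i j then 1 else 0

  degree : ∀ {n} → SimpleGraph n → Fin n → ℕ
  degree G i = sum (adjacency G i)

  adjacency≤1 : ∀ {n} (G : SimpleGraph n) i j → adjacency G i j ≤ 1
  adjacency≤1 G i j with adj G i j
  ... | true  = s≤s z≤n
  ... | false = z≤n

  adjacency-sym : ∀ {n} (G : SimpleGraph n) i j → adjacency G i j ≡ adjacency G j i
  adjacency-sym G i j = cong (λ b → if b then 1 else 0) (SimpleGraph.sym G i j)

  adjacency-split : ∀ {n} (G : SimpleGraph n) i j →
                    adjacency G i j ≡ upperAdjacency G i j + upperAdjacency G j i
  adjacency-split G i j
    with toℕ i <ᵇ toℕ j | <ᵇ-reflects-< (toℕ i) (toℕ j) | toℕ j <ᵇ toℕ i | <ᵇ-reflects-< (toℕ j) (toℕ i)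
  ... | true  | ofʸ i<j | true  | ofʸ j<i = contradiction j<i (<-asym i<j)
  ... | true  | ofʸ _   | false | ofⁿ _   = sym (+-identityʳ _)
  ... | false | ofⁿ _   | true  | ofʸ _   = adjacency-sym G i j
  ... | false | ofⁿ i≮j | false | ofⁿ j≮i =
    cong (λ b → if b then 1 else 0) (trans (cong (adj G i) (sym i≡j)) (irrefl G i))
    where
    i≡j : i ≡ j
    i≡j = toℕ-injective (≤-antisym (≮⇒≥ j≮i) (≮⇒≥ i≮j))

  numEdges≡sum : ∀ {n} (G : SimpleGraph n) → numEdges G ≡ sum (λ i → sum (upperAdjacency G i))
  numEdges≡sum {n} G =
    trans (cong ListAction.sum (map-cong (λ i → sum-allFin (upperAdjacency G i)) (List.allFin n)))
          (sum-allFin (λ i → sum (upperAdjacency G i)))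

  handshake : ∀ {n} (G : SimpleGraph n) → sum (degree G) ≡ 2 * numEdges G
  handshake G = begin
    sum (λ i → sum (adjacency G i))
      ≡⟨ sum-cong-≗ (λ i → trans (sum-cong-≗ (adjacency-split G i)) (∑-distrib-+ (upperAdjacency G i) _)) ⟩
    sum (λ i → sum (upperAdjacency G i) + sum (λ j → upperAdjacency G j i))
      ≡⟨ ∑-distrib-+ (λ i → sum (upperAdjacency G i)) _ ⟩
    E + sum (λ i → sum (λ j → upperAdjacency G j i))
      ≡⟨ cong (E +_) (∑-comm (upperAdjacency G)) ⟨
    E + E
      ≡⟨ cong (λ e → e + e) (numEdges≡sum G) ⟨
    numEdges G + numEdges G
      ≡⟨ double (numEdges G) ⟩
    2 * numEdges G ∎
    where
    open ≡-Reasoning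
    E = sum (λ i → sum (upperAdjacency G i))
    double : ∀ e → e + e ≡ 2 * e
    double = solve-∀

  degree≡sum-punchIn : ∀ {n} (G : SimpleGraph (suc n)) v →
                       degree G v ≡ sum (λ j → adjacency G v (punchIn v j))
  degree≡sum-punchIn G v = trans (sum-remove (adjacency G v))
    (cong (λ b → (if b then 1 else 0) + sum (λ j → adjacency G v (punchIn v j))) (irrefl G v))

  degree-≤ : ∀ {n} (G : SimpleGraph (suc n)) v → degree G v ≤ n
  degree-≤ {n} G v = begin
    degree G v                               ≡⟨ degree≡sum-punchIn G v ⟩
    sum (λ j → adjacency G v (punchIn v j))  ≤⟨ sum-mono-≤ (λ j → adjacency≤1 G v (punchIn v j)) ⟩
    sum (replicate n 1)                      ≡⟨ sum-replicate-* n 1 ⟩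
    n * 1                                    ≡⟨ *-identityʳ n ⟩
    n                                        ∎
    where open ≤-Reasoning

  numEdges-deleteVertex : ∀ {n} (G : SimpleGraph (suc n)) v →
                          numEdges (deleteVertex G v) + degree G v ≡ numEdges G
  numEdges-deleteVertex G v = *-cancelˡ-≡ _ _ 2 (begin
    2 * (e′ + d)                                  ≡⟨ rearrange e′ d ⟩
    d + (d + 2 * e′)                              ≡⟨ cong₂ (λ p q → d + (p + q)) d≡column (sym (handshake G′)) ⟩
    d + (sum column + sum (degree G′))            ≡⟨ cong (d +_) (∑-distrib-+ column (degree G′)) ⟨
    d + sum (λ i → column i + degree G′ i)
      ≡⟨ cong (d +_) (sum-cong-≗ (λ i → sum-remove (adjacency G (punchIn v i)))) ⟨
    d + sum (λ i → degree G (punchIn v i))        ≡⟨ sum-remove (degree G) ⟨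
    sum (degree G)                                ≡⟨ handshake G ⟩
    2 * numEdges G                                ∎)
    where
    open ≡-Reasoning
    G′ = deleteVertex G v
    e′ = numEdges G′
    d = degree G v
    column = λ i → adjacency G (punchIn v i) v
    d≡column : d ≡ sum column
    d≡column = trans (degree≡sum-punchIn G v) (sum-cong-≗ (λ i → adjacency-sym G v (punchIn v i)))
    rearrange : ∀ e d → 2 * (e + d) ≡ d + (d + 2 * e)
    rearrange = solve-∀

  numEdges≤C2 : ∀ {n} (G : SimpleGraph n) → numEdges G ≤ n C 2
  numEdges≤C2 {zero} G = z≤n
  numEdges≤C2 {suc n} G = begin
    numEdges G                                      ≡⟨ numEdges-deleteVertex G zero ⟨
    numEdges G′ + degree G zero                     ≤⟨ +-mono-≤ (numEdges≤C2 G′) (degree-≤ G zero) ⟩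
    n C 2 + n                                       ≡⟨ trans (+-comm (n C 2) n) (sym (C2-suc n)) ⟩
    suc n C 2                                       ∎
    where
    open ≤-Reasoning
    G′ = deleteVertex G zero

  sum-numEdges-deleteVertex : ∀ {n} (G : SimpleGraph (suc n)) →
    sum (λ v → numEdges (deleteVertex G v)) + 2 * numEdges G ≡ suc n * numEdges G
  sum-numEdges-deleteVertex {n} G = begin
    sum e′ + 2 * numEdges G                         ≡⟨ cong (sum e′ +_) (handshake G) ⟨
    sum e′ + sum (degree G)                         ≡⟨ ∑-distrib-+ e′ (degree G) ⟨
    sum (λ v → e′ v + degree G v)                   ≡⟨ sum-cong-≗ (numEdges-deleteVertex G) ⟩
    sum (replicate (suc n) (numEdges G))            ≡⟨ sum-replicate-* (suc n) (numEdges G) ⟩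
    suc n * numEdges G                              ∎
    where
    open ≡-Reasoning
    e′ = λ v → numEdges (deleteVertex G v)

module Density where
  open import Defs hiding (sym)
  open import Data.Integer using (+_)
  open import Data.Nat as ℕ using (zero; suc; s≤s; z≤n)
  open import Data.Nat.Combinatorics using (_C_)
  import Data.Nat.Properties as ℕP
  open import Data.Rational.Properties
  open import Algebra.Properties.Group +-0-group using () renaming (∙-cancelʳ to +-cancelʳ)
  open import Relation.Binary.PropositionalEquality
  open import Tactic.RingSolver using (solve-∀)
  open Rational
  open Graph
    using ( C2-suc; 2*C2-suc; [1+n]nC2+2[1+n]C2≡[1+n][1+n]C2; deleteVertex; degree; degree-≤
          ; numEdges≤C2; numEdges-deleteVertex; sum-numEdges-deleteVertex)

  density-*-C2 : ∀ a {n} → 2 ℕ.≤ n → density a n * fromℕ (n C 2) ≡ fromℕ a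
  density-*-C2 a {suc (suc m)} (s≤s (s≤s z≤n)) rewrite C2-suc (suc m) = /-*-fromℕ a (m ℕ.+ suc m C 2)

  density-nonNeg : ∀ a n → 0ℚ ≤ density a n
  density-nonNeg a n with n C 2
  ... | zero  = ≤-refl
  ... | suc d = nonNegative⁻¹ _ {{normalize-nonNeg a (suc d)}}

  density-mono-≤ : ∀ {a b} n → a ℕ.≤ b → density a n ≤ density b n
  density-mono-≤ {a} {b} n a≤b with n C 2
  ... | zero  = ≤-refl
  ... | suc d = *-cancelʳ-≤-pos (fromℕ (suc d))
                  (subst₂ _≤_ (sym (/-*-fromℕ a d)) (sym (/-*-fromℕ b d)) (fromℕ-mono-≤ a≤b))

  C2-pos : ∀ {n} → 2 ℕ.≤ n → 0ℚ < fromℕ (n C 2)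
  C2-pos {suc (suc m)} (s≤s (s≤s z≤n)) rewrite C2-suc (suc m) = fromℕ-mono-< (s≤s z≤n)

  fromℕ-C2-suc : ∀ n → fromℕ (suc n C 2) ≡ fromℕ (n C 2) + fromℕ n
  fromℕ-C2-suc n = trans (cong fromℕ (trans (C2-suc n) (ℕP.+-comm n (n C 2)))) (fromℕ-homo-+ (n C 2) n)

  sum-density-deleteVertex : ∀ {n} → 2 ℕ.≤ n → (G : SimpleGraph (suc n)) →
    sum (λ v → density (numEdges (deleteVertex G v)) n) ≡ fromℕ (suc n) * density (numEdges G) (suc n)
  sum-density-deleteVertex {n} 2≤n G =
    *-cancelʳ-≡-pos c (C2-pos 2≤n) (+-cancelʳ (fromℕ 2 * e) _ _ (trans Σx*c+2e≡me (sym my*c+2e≡me)))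
    where
    open ≡-Reasoning
    e′ = λ v → numEdges (deleteVertex G v)
    x = λ v → density (e′ v) n
    y = density (numEdges G) (suc n)
    c = fromℕ (n C 2)
    c′ = fromℕ (suc n C 2)
    e = fromℕ (numEdges G)
    m = fromℕ (suc n)
    2≤1+n = ℕP.m≤n⇒m≤1+n 2≤n
    Σx*c+2e≡me : sum x * c + fromℕ 2 * e ≡ m * e
    Σx*c+2e≡me = begin
      sum x * c + fromℕ 2 * e
        ≡⟨ cong (_+ fromℕ 2 * e) (trans (*-distribʳ-sum c x) (sum-cong-≗ (λ v → density-*-C2 (e′ v) 2≤n))) ⟩
      sum (fromℕ ∘ e′) + fromℕ 2 * e
        ≡⟨ cong₂ _+_ (fromℕ-homo-sum e′) (fromℕ-homo-* 2 (numEdges G)) ⟨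
      fromℕ (ℕΣ.sum e′) + fromℕ (2 ℕ.* numEdges G)  ≡⟨ fromℕ-homo-+ (ℕΣ.sum e′) (2 ℕ.* numEdges G) ⟨
      fromℕ (ℕΣ.sum e′ ℕ.+ 2 ℕ.* numEdges G)       ≡⟨ cong fromℕ (sum-numEdges-deleteVertex G) ⟩
      fromℕ (suc n ℕ.* numEdges G)                  ≡⟨ fromℕ-homo-* (suc n) (numEdges G) ⟩
      m * e                                         ∎
    my*c+2e≡me : m * y * c + fromℕ 2 * e ≡ m * e
    my*c+2e≡me = begin
      m * y * c + fromℕ 2 * e         ≡⟨ cong (λ e → m * y * c + fromℕ 2 * e) (density-*-C2 (numEdges G) 2≤1+n) ⟨
      m * y * c + fromℕ 2 * (y * c′)  ≡⟨ factor m y c c′ ⟩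
      y * (m * c + fromℕ 2 * c′)
        ≡⟨ cong (y *_) (cong₂ _+_ (fromℕ-homo-* (suc n) (n C 2)) (fromℕ-homo-* 2 (suc n C 2))) ⟨
      y * (fromℕ (suc n ℕ.* (n C 2)) + fromℕ (2 ℕ.* (suc n C 2)))
        ≡⟨ cong (y *_) (fromℕ-homo-+ (suc n ℕ.* (n C 2)) (2 ℕ.* (suc n C 2))) ⟨
      y * fromℕ (suc n ℕ.* (n C 2) ℕ.+ 2 ℕ.* (suc n C 2))
        ≡⟨ cong (λ k → y * fromℕ k) ([1+n]nC2+2[1+n]C2≡[1+n][1+n]C2 n) ⟩
      y * fromℕ (suc n ℕ.* (suc n C 2))  ≡⟨ cong (y *_) (fromℕ-homo-* (suc n) (suc n C 2)) ⟩
      y * (m * c′)                       ≡⟨ swap y m c′ ⟩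
      m * (y * c′)                       ≡⟨ cong (m *_) (density-*-C2 (numEdges G) 2≤1+n) ⟩
      m * e                              ∎
      where
      factor : ∀ m y c c′ → m * y * c + fromℕ 2 * (y * c′) ≡ y * (m * c + fromℕ 2 * c′)
      factor = solve-∀ ℚ-ring
      swap : ∀ y m c′ → y * (m * c′) ≡ m * (y * c′)
      swap = solve-∀ ℚ-ring

  density-deleteVertex-dist² : ∀ {n} → 2 ℕ.≤ n → (G : SimpleGraph (suc n)) → ∀ v →
    (density (numEdges (deleteVertex G v)) n - density (numEdges G) (suc n)) ² ≤ (+ 2 / suc n) ²
  density-deleteVertex-dist² {n} 2≤n G v =
    mediant-dist² {x = density (numEdges G′) n} {y = density (numEdges G) (suc n)} {r = r}
      (fromℕ-nonNeg _) (fromℕ-mono-≤ (numEdges≤C2 G′)) (fromℕ-nonNeg _) (fromℕ-mono-≤ (degree-≤ G v))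
      (C2-pos 2≤n) (density-*-C2 (numEdges G′) 2≤n) y-mediant r-mediant
    where
    open ≡-Reasoning
    G′ = deleteVertex G v
    r = + 2 / suc n
    y-mediant : density (numEdges G) (suc n) * (fromℕ (n C 2) + fromℕ n) ≡
                fromℕ (numEdges G′) + fromℕ (degree G v)
    y-mediant = begin
      density (numEdges G) (suc n) * (fromℕ (n C 2) + fromℕ n)
        ≡⟨ cong (density (numEdges G) (suc n) *_) (fromℕ-C2-suc n) ⟨
      density (numEdges G) (suc n) * fromℕ (suc n C 2)  ≡⟨ density-*-C2 (numEdges G) (ℕP.m≤n⇒m≤1+n 2≤n) ⟩
      fromℕ (numEdges G)                                ≡⟨ cong fromℕ (numEdges-deleteVertex G v) ⟨
      fromℕ (numEdges G′ ℕ.+ degree G v)                ≡⟨ fromℕ-homo-+ (numEdges G′) (degree G v) ⟩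
      fromℕ (numEdges G′) + fromℕ (degree G v)          ∎
    r-mediant : r * (fromℕ (n C 2) + fromℕ n) ≡ fromℕ n
    r-mediant = *-cancelʳ-≡-pos (fromℕ 2) (fromℕ-mono-< (s≤s z≤n)) (begin
      r * (fromℕ (n C 2) + fromℕ n) * fromℕ 2  ≡⟨ cong (λ q → r * q * fromℕ 2) (fromℕ-C2-suc n) ⟨
      r * fromℕ (suc n C 2) * fromℕ 2          ≡⟨ *-assoc r (fromℕ (suc n C 2)) (fromℕ 2) ⟩
      r * (fromℕ (suc n C 2) * fromℕ 2)        ≡⟨ cong (r *_) (fromℕ-homo-* (suc n C 2) 2) ⟨
      r * fromℕ ((suc n C 2) ℕ.* 2)            ≡⟨ cong (λ k → r * fromℕ k) (ℕP.*-comm (suc n C 2) 2) ⟩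
      r * fromℕ (2 ℕ.* (suc n C 2))            ≡⟨ cong (λ k → r * fromℕ k) (2*C2-suc n) ⟩
      r * fromℕ (suc n ℕ.* n)                  ≡⟨ cong (r *_) (fromℕ-homo-* (suc n) n) ⟩
      r * (fromℕ (suc n) * fromℕ n)            ≡⟨ *-assoc r (fromℕ (suc n)) (fromℕ n) ⟨
      r * fromℕ (suc n) * fromℕ n              ≡⟨ cong (_* fromℕ n) (/-*-fromℕ 2 n) ⟩
      fromℕ 2 * fromℕ n                        ≡⟨ *-comm (fromℕ 2) (fromℕ n) ⟩
      fromℕ n * fromℕ 2                        ∎)

module Subsystem where
  open import Defs hiding (sym)
  open import Data.Integer using (+_)
  open import Data.Nat as ℕ using (zero; suc; s≤s; z≤n)
  import Data.Nat.Properties as ℕP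
  open import Data.Product using (_×_)
  open import Data.Rational using (positive; nonNegative)
  open import Data.Rational.Properties
  open import Data.Vec.Functional using (Vector; replicate)
  open import Relation.Binary.PropositionalEquality
  open import Relation.Nullary using (¬_; contradiction)
  open import Tactic.RingSolver using (solve-∀)
  open Rational
  open Graph using (deleteVertex; deleteVertexˢ; deleteVertexˢ-rainbowFree)
  open Density

  densities : ∀ {k n} → GraphSystem k n → Vector ℚ k
  densities {n = n} 𝒢 i = density (numEdges (𝒢 i)) n

  dist² : ∀ {k} → Vector ℚ k → Vector ℚ k → ℚ
  dist² x y = sum (λ i → (x i - y i) ²)

  dist²-self : ∀ {k} (x : Vector ℚ k) → dist² x x ≡ 0ℚ
  dist²-self {k} x = trans (sum-cong-≗ (λ i → cong _² (+-inverseʳ (x i)))) (sum-replicate-zero k)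

  ∃-deleteVertex-dist² : ∀ {k n} → 2 ℕ.≤ n → (c : Vector ℚ k) (𝒢 : GraphSystem k (suc n)) →
    ∃[ v ] dist² (densities (deleteVertexˢ 𝒢 v)) c ≤ dist² (densities 𝒢) c + fromℕ k * (+ 2 / suc n) ²
  ∃-deleteVertex-dist² {k} {n} 2≤n c 𝒢 =
    ∃-≤-mean (λ v → dist² (densities (deleteVertexˢ 𝒢 v)) c) _ (begin
    sum (λ v → sum (λ i → (x i v - c i) ²))  ≡⟨ ∑-comm (λ v i → (x i v - c i) ²) ⟩
    sum (λ i → sum (λ v → (x i v - c i) ²))
      ≡⟨ sum-cong-≗ (λ i → sum-sq-shift (x i) (c i) (d i) (sum-density-deleteVertex 2≤n (𝒢 i))) ⟩
    sum (λ i → sum (λ v → (x i v - d i) ²) + m * (d i - c i) ²)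
      ≤⟨ sum-mono-≤ (λ i → +-monoˡ-≤ (m * (d i - c i) ²) (deviation i)) ⟩
    sum (λ i → m * β + m * (d i - c i) ²)    ≡⟨ sum-cong-≗ (λ i → factor m β ((d i - c i) ²)) ⟩
    sum (λ i → m * ((d i - c i) ² + β))      ≡⟨ *-distribˡ-sum m (λ i → (d i - c i) ² + β) ⟨
    m * sum (λ i → (d i - c i) ² + β)        ≡⟨ cong (m *_) (∑-distrib-+ (λ i → (d i - c i) ²) (replicate k β)) ⟩
    m * (dist² d c + sum (replicate k β))    ≡⟨ cong (λ s → m * (dist² d c + s)) (sum-replicate-* k β) ⟩
    m * (dist² d c + fromℕ k * β)            ∎)
    where
    open ≤-Reasoning
    x = λ i v → density (numEdges (deleteVertex (𝒢 i) v)) n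
    d = densities 𝒢
    m = fromℕ (suc n)
    β = (+ 2 / suc n) ²
    deviation : ∀ i → sum (λ v → (x i v - d i) ²) ≤ m * β
    deviation i = ≤-trans (sum-mono-≤ (density-deleteVertex-dist² 2≤n (𝒢 i)))
                          (≤-reflexive (sum-replicate-* (suc n) β))
    factor : ∀ m β s → m * β + m * s ≡ m * (s + β)
    factor = solve-∀ ℚ-ring

  -- The constant 8 makes budget n ≥ ∑_{m ≥ n} (2/(m+1))², the squared drift of all later deletions.
  budget : ℕ → ℚ
  budget n = + 8 / suc n

  budget-nonNeg : ∀ n → 0ℚ ≤ budget n
  budget-nonNeg n = nonNegative⁻¹ _ {{normalize-nonNeg 8 (suc n)}}

  budget-step : ∀ n → (+ 2 / suc n) ² + budget (suc n) ≤ budget n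
  budget-step n = bound {+ 2 / suc n} {budget n} {budget (suc n)} {fromℕ (suc n)}
    (/-*-fromℕ 2 n) (/-*-fromℕ 8 n) (subst (λ w → budget (suc n) * w ≡ fromℕ 8) u+1≡w (/-*-fromℕ 8 (suc n)))
    (fromℕ-mono-≤ (s≤s z≤n))
    where
    u+1≡w : fromℕ (suc (suc n)) ≡ fromℕ (suc n) + 1ℚ
    u+1≡w = trans (fromℕ-homo-+ 1 (suc n)) (+-comm 1ℚ (fromℕ (suc n)))
    bound : ∀ {r b b′ u} → r * u ≡ fromℕ 2 → b * u ≡ fromℕ 8 → b′ * (u + 1ℚ) ≡ fromℕ 8 → 1ℚ ≤ u →
            r ² + b′ ≤ b
    bound {r} {b} {b′} {u} ru≡2 bu≡8 b′[u+1]≡8 1≤u =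
      *-cancelʳ-≤-pos P {{positive (*-pos (*-pos 0<u 0<u) 0<u+1)}} (begin
        (r * r + b′) * P                                         ≡⟨ expandˡ r b′ u ⟩
        (r * u) * (r * u) * (u + 1ℚ) + b′ * (u + 1ℚ) * (u * u)
          ≡⟨ cong₂ (λ p q → p * p * (u + 1ℚ) + q * (u * u)) ru≡2 b′[u+1]≡8 ⟩
        fromℕ 2 * fromℕ 2 * (u + 1ℚ) + fromℕ 8 * (u * u)
          ≤⟨ 0≤q-p⇒p≤q (subst (0ℚ ≤_) (gap u) (*-nonNeg (fromℕ-nonNeg 4) (p≤q⇒0≤q-p 1≤u))) ⟩
        fromℕ 8 * (u * (u + 1ℚ))                                 ≡⟨ cong (_* (u * (u + 1ℚ))) bu≡8 ⟨
        b * u * (u * (u + 1ℚ))                                   ≡⟨ expandʳ b u ⟩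
        b * P                                                    ∎)
      where
      open ≤-Reasoning
      P = u * u * (u + 1ℚ)
      0<u = <-≤-trans (positive⁻¹ 1ℚ) 1≤u
      0<u+1 = <-≤-trans 0<u (subst (_≤ u + 1ℚ) (+-identityʳ u) (+-monoʳ-≤ u (<⇒≤ (positive⁻¹ 1ℚ))))
      expandˡ : ∀ r b′ u → (r * r + b′) * (u * u * (u + 1ℚ)) ≡
                           (r * u) * (r * u) * (u + 1ℚ) + b′ * (u + 1ℚ) * (u * u)
      expandˡ = solve-∀ ℚ-ring
      expandʳ : ∀ b u → b * u * (u * (u + 1ℚ)) ≡ b * (u * u * (u + 1ℚ))
      expandʳ = solve-∀ ℚ-ring
      gap : ∀ u → fromℕ 4 * (u - 1ℚ) ≡
                  fromℕ 8 * (u * (u + 1ℚ)) - (fromℕ 2 * fromℕ 2 * (u + 1ℚ) + fromℕ 8 * (u * u))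
      gap = solve-∀ ℚ-ring

  *-budget→0 : ∀ a q → 0ℚ < q → ∃[ j ] ∀ {m} → j ℕ.≤ m → a * budget m < q
  *-budget→0 a q 0<q =
    let j , 8a<jq = archimedean (a * fromℕ 8) q 0<q
    in j , λ {m} j≤m → *-cancelʳ-<-nonNeg (fromℕ (suc m)) (begin-strict
         a * budget m * fromℕ (suc m)    ≡⟨ *-assoc a (budget m) (fromℕ (suc m)) ⟩
         a * (budget m * fromℕ (suc m))  ≡⟨ cong (a *_) (/-*-fromℕ 8 m) ⟩
         a * fromℕ 8                     <⟨ 8a<jq ⟩
         fromℕ j * q
           ≤⟨ *-monoʳ-≤-nonNeg q {{nonNegative (<⇒≤ 0<q)}} (fromℕ-mono-≤ (ℕP.m≤n⇒m≤1+n j≤m)) ⟩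
         fromℕ (suc m) * q               ≡⟨ *-comm (fromℕ (suc m)) q ⟩
         q * fromℕ (suc m)               ∎)
    where open ≤-Reasoning

  potential : ∀ {k n} → Vector ℚ k → GraphSystem k n → ℚ
  potential {k} {n} c 𝒢 = dist² (densities 𝒢) c - fromℕ k * budget n

  ∃-deleteVertex-potential : ∀ {k n} → 2 ℕ.≤ n → (c : Vector ℚ k) (𝒢 : GraphSystem k (suc n)) →
                             ∃[ v ] potential c (deleteVertexˢ 𝒢 v) ≤ potential c 𝒢
  ∃-deleteVertex-potential {k} {n} 2≤n c 𝒢 =
    let v , D′≤D+kβ = ∃-deleteVertex-dist² 2≤n c 𝒢
    in v , 0≤q-p⇒p≤q (subst (0ℚ ≤_) (gap D (dist² (densities (deleteVertexˢ 𝒢 v)) c) (fromℕ k) β b b′)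
             (+-mono-≤ (p≤q⇒0≤q-p D′≤D+kβ) (*-nonNeg (fromℕ-nonNeg k) (p≤q⇒0≤q-p (budget-step n)))))
    where
    D = dist² (densities 𝒢) c
    β = (+ 2 / suc n) ²
    b = budget n
    b′ = budget (suc n)
    gap : ∀ D D′ k β b b′ → (D + k * β - D′) + k * (b - (β + b′)) ≡ (D - k * b′) - (D′ - k * b)
    gap = solve-∀ ℚ-ring

  shrink : ∀ {k m n H} → 2 ℕ.≤ m → m ℕ.≤′ n → (c : Vector ℚ k) (𝒢 : GraphSystem k n) → RainbowFree 𝒢 H →
           ∃[ 𝒢′ ] RainbowFree {k} {m} 𝒢′ H × potential c 𝒢′ ≤ potential c 𝒢
  shrink 2≤m ℕ.≤′-refl c 𝒢 𝒢-free = 𝒢 , 𝒢-free , ≤-refl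
  shrink {H = H} 2≤m (ℕ.≤′-step m≤′n) c 𝒢 𝒢-free =
    let v , Ψv≤Ψ = ∃-deleteVertex-potential (ℕP.≤-trans 2≤m (ℕP.≤′⇒≤ m≤′n)) c 𝒢
        𝒢′ , 𝒢′-free , Ψ′≤Ψv =
          shrink {H = H} 2≤m m≤′n c (deleteVertexˢ 𝒢 v) (deleteVertexˢ-rainbowFree {H = H} {𝒢} v 𝒢-free)
    in 𝒢′ , 𝒢′-free , ≤-trans Ψ′≤Ψv Ψv≤Ψ

  ∃-subsystem-dist² : ∀ {k m n H} → 2 ℕ.≤ m → m ℕ.≤ n → (𝒢 : GraphSystem k n) → RainbowFree 𝒢 H →
    ∃[ 𝒢′ ] RainbowFree {k} {m} 𝒢′ H × dist² (densities 𝒢′) (densities 𝒢) ≤ fromℕ k * budget m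
  ∃-subsystem-dist² {k} {m} {n} {H} 2≤m m≤n 𝒢 𝒢-free =
    let 𝒢′ , 𝒢′-free , Ψ′≤Ψ = shrink {H = H} 2≤m (ℕP.≤⇒≤′ m≤n) d 𝒢 𝒢-free
        D′ = dist² (densities 𝒢′) d
    in 𝒢′ , 𝒢′-free , (begin
      D′               ≡⟨ split D′ K ⟩
      (D′ - K) + K     ≤⟨ +-monoˡ-≤ K Ψ′≤Ψ ⟩
      (dist² d d - L) + K  ≡⟨ cong (λ s → s - L + K) (dist²-self d) ⟩
      (0ℚ - L) + K     ≤⟨ +-monoˡ-≤ K (subst (_≤ 0ℚ) (sym (+-identityˡ (- L))) (neg-antimono-≤ 0≤L)) ⟩
      0ℚ + K           ≡⟨ +-identityˡ K ⟩
      K                ∎)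
    where
    open ≤-Reasoning
    d = densities 𝒢
    K = fromℕ k * budget m
    L = fromℕ k * budget n
    0≤L = *-nonNeg (fromℕ-nonNeg k) (budget-nonNeg n)
    split : ∀ p q → p ≡ p - q + q
    split = solve-∀ ℚ-ring

  -- With no colours MinEdgesAtLeast holds for every bound, so the maximum defining ex* does not exist.
  ¬IsEx-zero : ∀ {n H a} → ¬ IsEx 0 n H a
  ¬IsEx-zero ((𝒢 , 𝒢-free , _) , maximal) = ℕP.<-irrefl refl (maximal 𝒢 _ 𝒢-free (λ ()))

  density-ex-almostNonIncreasing : ∀ {k H m n a b γ} → 2 ℕ.≤ m → m ℕ.≤ n → IsEx k m H a → IsEx k n H b →
                                   0ℚ ≤ γ → fromℕ k * budget m < γ ² → density b n - γ < density a m
  density-ex-almostNonIncreasing {zero} {H} _ _ _ exn _ _ = contradiction exn (¬IsEx-zero {H = H})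
  density-ex-almostNonIncreasing {suc k} {H} {m} {n} {a} {b} {γ}
    2≤m m≤n (_ , a-max) ((𝒢 , 𝒢-free , 𝒢≥b) , _) 0≤γ kbₘ<γ² =
    let 𝒢′ , 𝒢′-free , D′≤kbₘ = ∃-subsystem-dist² {H = H} 2≤m m≤n 𝒢 𝒢-free
        i , i-min = ∃-argmin ℕP.≤-totalPreorder (λ j → numEdges (𝒢′ j))
        d = densities 𝒢
        d′ = densities 𝒢′
    in begin-strict
      density b n - γ  ≤⟨ +-monoˡ-≤ (- γ) (density-mono-≤ n (𝒢≥b i)) ⟩
      d i - γ          <⟨ [x-y]²<γ²⇒y-γ<x 0≤γ (begin-strict
                            (d′ i - d i) ²            ≤⟨ term≤sum _ (λ j → ²-nonNeg (d′ j - d j)) i ⟩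
                            dist² d′ d                ≤⟨ D′≤kbₘ ⟩
                            fromℕ (suc k) * budget m  <⟨ kbₘ<γ² ⟩
                            γ ²                       ∎) ⟩
      d′ i             ≤⟨ density-mono-≤ m (a-max 𝒢′ _ 𝒢′-free i-min) ⟩
      density a m      ∎
    where open ≤-Reasoning

  density-ex-eventually-almostNonIncreasing : ∀ H k γ → 0ℚ < γ →
    ∃[ M ] Cauchy.AlmostNonIncreasingFrom (λ m a → IsEx k m H a) (λ m a → density a m) γ M
  density-ex-eventually-almostNonIncreasing H k γ 0<γ =
    let j , kbₘ<γ² = *-budget→0 (fromℕ k) (γ ²) (*-pos 0<γ 0<γ)
    in 2 ℕ.+ j , λ 2+j≤m m≤n exm exn →
         density-ex-almostNonIncreasing {H = H} (ℕP.≤-trans (ℕP.m≤m+n 2 j) 2+j≤m) m≤n exm exn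
           (<⇒≤ 0<γ) (kbₘ<γ² (ℕP.≤-trans (ℕP.m≤n+m j 2) 2+j≤m))

open import Defs
open import Data.Nat using (ℕ; _≤_)
open import Data.Product using (∃-syntax)
open import Data.Rational using (ℚ; 0ℚ; _<_; _-_; ∣_∣)
open import Relation.Nullary using (¬_)
open Density using (density-nonNeg)
open Subsystem using (density-ex-eventually-almostNonIncreasing)

theorem1p1 : (H : Multigraph) (k : ℕ) → ne H ≤ k →
    ∀ (ε : ℚ) → 0ℚ < ε →
      ¬ ¬ (∃[ N ] (∀ m n a b → N ≤ m → N ≤ n → IsEx k m H a → IsEx k n H b →
             ∣ density a m - density b n ∣ < ε))
theorem1p1 H k _ = Cauchy.¬¬-cauchy (λ m a → IsEx k m H a) (λ m a → density a m)
  (λ m a → density-nonNeg a m) (density-ex-eventually-almostNonIncreasing H k)
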